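{- Let $n\ge1$, $h\ge1$, $0\le\bar w\le n$, let $H$ be a multiset of $h$ binary strings each of length $n$ and weight $\bar w$, and let $M=M(H)$. Let $f,f'$ be two cumulative weight functions that are solutions to $M$, let $m,m'\in[2h]$ and $[l_1,l_2]\subset[n]$. If $f_m(l_2)=f'_{m'}(l_2)$ and $f_m(l_1)\ne f'_{m'}(l_1)$, then there is a branching point in $\mathcal{G}(f_m,[l_1+1,l_2])$. Similarly, if $f_m(l_2)\ne f'_{m'}(l_2)$ and $f_m(l_1)=f'_{m'}(l_1)$, then there is a merging point in $\mathcal{G}(f_m,[l_1,l_2-1])$.
   Context: Notation: $[n]=\{1,\dots,n\}$; $[n_1,n_2]=\{n_1,\dots,n_2\}$ if $n_1\le n_2$, else $\emptyset$. For a binary string $t$ of length $n$, $\mathrm{wt}(t)$ is its number of ones, $t[l]$, $t[-l]$ its length-$l$ prefix and suffix; $M(t)$ is the multiset union of $\{(j-\mathrm{wt}(t[j]),\mathrm{wt}(t[j])) : j\in[n]\}$ and $\{(j-\mathrm{wt}(t[-j]),\mathrm{wt}(t[-j])) : j\in[n]\}$, and $M(H)$ is the multiset union of $M(t)$, $t\in H$. A cumulative weight function (CWF) is $f:\{0,\dots,n\}\times[2h]\to\{0,\dots,n\}$ with (a) $f(0,m)=0$; (b) $f(l,m)-f(l-1,m)\in\{0,1\}$ for $(l,m)\in[n]\times[2h]$; (c) for each $j\in[h]$ there is $w_j$ with $f(l,2j-1)+f(n-l,2j)=w_j$ for all $l\in\{0,\dots,n\}$. Write $f_m(l)=f(l,m)$.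 $f$ is a solution to $M$ if $M=\{(l-f_m(l),f_m(l)): m\in[2h],l\in[n]\}$ as multisets. For $I\subset\{0,\dots,n\}$, $\mathcal{G}(f_m,I)=\{(l,f_m(l)):l\in I\}$. With $A(l,w)=\{m\in[2h]: f_m(l)=w\}$ (computed for the solution $f$), set for $(l,w)\in[n]^2$: $b_{l,w}=|A(l,w)\cap A(l-1,w)|$, $c_{l,w}=|A(l,w)\cap A(l-1,w-1)|$, and $b_{l,0}=|A(l,0)|$, $c_{l,0}=0$ for $l\in[n]$. A point $(l,w)\in\{0,\dots,n\}^2$ is a branching point if $b_{l,w}>0$ and $c_{l,w}>0$, and a merging point if $b_{l+1,w}>0$ and $c_{l+1,w+1}>0$. -}

module Defs where

open import Data.Bool using (Bool; true; false)
open import Data.Nat using (ℕ; zero; suc; _+_; _*_; _∸_; _≤_; _≟_)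
open import Data.List using (List; []; _∷_; _++_; length; filter; map; concatMap; upTo; take; drop)
open import Data.List.Relation.Binary.Permutation.Propositional using (_↭_)
open import Data.Vec using (Vec; toList)
open import Data.Product using (_×_; _,_; ∃-syntax)
open import Data.Sum using (_⊎_)
open import Relation.Binary.PropositionalEquality using (_≡_)
open import Relation.Nullary.Decidable using (_×-dec_)

wtL : List Bool → ℕ
wtL [] = 0
wtL (true ∷ bs) = suc (wtL bs)
wtL (false ∷ bs) = wtL bs

prefWt : ∀ {n} → Vec Bool n → ℕ → ℕ
prefWt t j = wtL (take j (toList t))

sufWt : ∀ {n} → Vec Bool n → ℕ → ℕ
sufWt {n} t j = wtL (drop (n ∸ j) (toList t))

range1 : ℕ → List ℕ
range1 n = map suc (upTo n)

-- M(t), as a list considered up to permutation (multiset)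
Mt : ∀ n → Vec Bool n → List (ℕ × ℕ)
Mt n t = map (λ j → (j ∸ prefWt t j , prefWt t j)) (range1 n)
      ++ map (λ j → (j ∸ sufWt t j , sufWt t j)) (range1 n)

MH : ∀ n h → Vec (Vec Bool n) h → List (ℕ × ℕ)
MH n h H = concatMap (Mt n) (toList H)

-- A function f : {0..n} × [2h] → {0..n}, written f m l = f_m(l),
-- with m ranging over [2h] = {1..2h} (1-based as in the paper);
-- values outside the domain are irrelevant.
record IsCWF (n h : ℕ) (f : ℕ → ℕ → ℕ) : Set where
  field
    codom : ∀ m l → 1 ≤ m → m ≤ 2 * h → l ≤ n → f m l ≤ n
    start : ∀ m → 1 ≤ m → m ≤ 2 * h → f m 0 ≡ 0
    step  : ∀ l m → 1 ≤ l → l ≤ n → 1 ≤ m → m ≤ 2 * h →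
              (f m l ≡ f m (l ∸ 1)) ⊎ (f m l ≡ suc (f m (l ∸ 1)))
    pair  : ∀ j → 1 ≤ j → j ≤ h → ∃[ w ] (∀ l → l ≤ n →
              f (2 * j ∸ 1) l + f (2 * j) (n ∸ l) ≡ w)

IsSolution : (n h : ℕ) → (ℕ → ℕ → ℕ) → List (ℕ × ℕ) → Set
IsSolution n h f M =
  M ↭ concatMap (λ m → map (λ l → (l ∸ f m l , f m l)) (range1 n)) (range1 (2 * h))

bcount : (h : ℕ) → (ℕ → ℕ → ℕ) → ℕ → ℕ → ℕ
bcount h f l zero = length (filter (λ m → f m l ≟ 0) (range1 (2 * h)))
bcount h f l (suc w) =
  length (filter (λ m → (f m l ≟ suc w) ×-dec (f m (l ∸ 1) ≟ suc w)) (range1 (2 * h)))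

ccount : (h : ℕ) → (ℕ → ℕ → ℕ) → ℕ → ℕ → ℕ
ccount h f l zero = 0
ccount h f l (suc w) =
  length (filter (λ m → (f m l ≟ suc w) ×-dec (f m (l ∸ 1) ≟ w)) (range1 (2 * h)))

Branching : (h : ℕ) → (ℕ → ℕ → ℕ) → ℕ → ℕ → Set
Branching h f l w = (1 ≤ bcount h f l w) × (1 ≤ ccount h f l w)

Merging : (h : ℕ) → (ℕ → ℕ → ℕ) → ℕ → ℕ → Set
Merging h f l w = (1 ≤ bcount h f (suc l) w) × (1 ≤ ccount h f (suc l) (suc w))

-- A solution f lists the points (l - f_m(l), f_m(l)), and since f_m(l) ≤ l such a point
-- lies on the antidiagonal of its length l.  Hence two solutions f, f' of the same M have
-- the same multiset {f_m(l) : m} at every length l; this is all that is used of M.  Because every f_m moves in unit steps,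
--   c_{l+1,w+1} = #{m : f_m(l) ≤ w} - #{m : f_m(l+1) ≤ w},
--   b_{l+1,w+1} = #{m : f_m(l+1) = w+1} - c_{l+1,w+1},
-- so f and f' have the same b and c.  Where f_m and f'_{m'} disagree at k but agree at
-- k+1, one of them stays flat and the other rises into the common value, so that point
-- is branching; where they agree at k but not at k+1, the point (k, f_m(k)) is merging.

module Submission where

open import Defs
open import Data.Bool using (Bool)
open import Data.Nat using (ℕ; zero; suc; _+_; _∸_; _*_; _≤_; _≤′_; ≤′-refl; ≤′-step; z≤n; s≤s; _≟_; _≤?_)
open import Data.Nat.Properties
open import Data.List using (List; []; _∷_; _++_; length; filter; map; concat; concatMap)
open import Data.List.Properties using (filter-++; filter-accept; filter-reject; filter-none; filter-some; length-map; map-∘; map-cong-local; concatMap-map; concatMap-pure)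
open import Data.List.Membership.Propositional using (_∈_; lose)
open import Data.List.Membership.Propositional.Properties using (∈-map⁺; ∈-map⁻; ∈-upTo⁺; ∈-upTo⁻)
open import Data.List.Relation.Unary.Any using (here; there)
open import Data.List.Relation.Unary.All as ListAll using ([]; _∷_)
open import Data.List.Relation.Unary.Unique.Propositional using (Unique)
open import Data.List.Relation.Unary.AllPairs using (_∷_)
import Data.List.Relation.Unary.Unique.Propositional.Properties as Unique
open import Data.List.Relation.Binary.Permutation.Propositional using (_↭_; ↭-sym; ↭-trans)
open import Data.List.Relation.Binary.Permutation.Propositional.Properties using (filter-↭; map⁺; ↭-length)
open import Data.Vec using (Vec)
open import Data.Vec.Relation.Unary.All using (All)
open import Data.Product using (_×_; _,_; proj₁; proj₂; ∃-syntax)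
open import Data.Sum using (_⊎_; inj₁; inj₂; [_,_])
open import Data.Empty using (⊥; ⊥-elim)
open import Function using (_∘_; id)
open import Function.Bundles using (_⇔_; mk⇔; Equivalence)
open import Relation.Nullary using (¬_; yes; no)
open import Relation.Nullary.Decidable using (¬?; decidable-stable)
open import Relation.Unary using (Pred; Decidable)
open import Relation.Binary.PropositionalEquality using (_≡_; _≢_; refl; sym; trans; cong; subst; subst₂; module ≡-Reasoning)

private
  variable
    A B : Set
    P Q R : Pred A _

filter-map : (P? : Decidable P) (g : B → A) (xs : List B) →
  filter P? (map g xs) ≡ map g (filter (P? ∘ g) xs)
filter-map P? g [] = refl
filter-map P? g (x ∷ xs) with P? (g x)
... | yes _ = cong (g x ∷_) (filter-map P? g xs)
... | no _ = filter-map P? g xs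

length-filter-map : (P? : Decidable P) (g : B → A) (xs : List B) →
  length (filter P? (map g xs)) ≡ length (filter (P? ∘ g) xs)
length-filter-map P? g xs = trans (cong length (filter-map P? g xs)) (length-map g (filter (P? ∘ g) xs))

filter-concatMap : (P? : Decidable P) (G : B → List A) (xs : List B) →
  filter P? (concatMap G xs) ≡ concatMap (filter P? ∘ G) xs
filter-concatMap P? G [] = refl
filter-concatMap P? G (x ∷ xs) =
  trans (filter-++ P? (G x) (concatMap G xs)) (cong (filter P? (G x) ++_) (filter-concatMap P? G xs))

concatMap-singleton : (g : B → A) (xs : List B) → concatMap (λ x → g x ∷ []) xs ≡ map g xs
concatMap-singleton g xs = trans (sym (concatMap-map (_∷ []) g xs)) (concatMap-pure (map g xs))

filter-unique : (P? : Decidable P) {x : A} {xs : List A} → Unique xs → x ∈ xs → P x →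
  (∀ {y} → y ∈ xs → P y → y ≡ x) → filter P? xs ≡ x ∷ []
filter-unique P? (y∉ys ∷ _) (here refl) px only =
  trans (filter-accept P? px)
    (cong (_ ∷_) (filter-none P? (ListAll.tabulate λ z∈ys pz → ListAll.lookup y∉ys z∈ys (sym (only (there z∈ys) pz)))))
filter-unique P? (y∉ys ∷ uys) (there x∈ys) px only =
  trans (filter-reject P? λ py → ListAll.lookup y∉ys (subst (_∈ _) (sym (only (here refl) py)) x∈ys) refl)
    (filter-unique P? uys x∈ys px (only ∘ there))

count-split : (P? : Decidable P) (Q? : Decidable Q) (R? : Decidable R) {xs : List A} →
  ListAll.All (λ x → P x ⇔ (Q x ⊎ R x)) xs → (∀ {x} → Q x → R x → ⊥) →
  length (filter P? xs) ≡ length (filter Q? xs) + length (filter R? xs)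
count-split P? Q? R? [] disjoint = refl
count-split P? Q? R? {x ∷ xs} (p⇔q⊎r ∷ rest) disjoint with P? x | Q? x | R? x
... | _ | yes q | yes r = ⊥-elim (disjoint q r)
... | yes _ | yes _ | no _ = cong suc (count-split P? Q? R? rest disjoint)
... | yes _ | no _ | yes _ =
  trans (cong suc (count-split P? Q? R? rest disjoint)) (sym (+-suc _ _))
... | yes p | no ¬q | no ¬r = ⊥-elim ([ ¬q , ¬r ] (Equivalence.to p⇔q⊎r p))
... | no ¬p | yes q | no _ = ⊥-elim (¬p (Equivalence.from p⇔q⊎r (inj₁ q)))
... | no ¬p | no _ | yes r = ⊥-elim (¬p (Equivalence.from p⇔q⊎r (inj₂ r)))
... | no _ | no _ | no _ = count-split P? Q? R? rest disjoint

crossing : (P? : Decidable P) {l₁ l₂ : ℕ} → l₁ ≤′ l₂ → P l₁ → ¬ P l₂ →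
  ∃[ k ] (l₁ ≤ k × suc k ≤ l₂ × P k × ¬ P (suc k))
crossing P? ≤′-refl p ¬p = ⊥-elim (¬p p)
crossing P? (≤′-step {l} l₁≤′l) p ¬p with P? l
... | yes pl = l , ≤′⇒≤ l₁≤′l , ≤-refl , pl , ¬p
... | no ¬pl with crossing P? l₁≤′l p ¬pl
...   | k , l₁≤k , k<l , pk , ¬pk = k , l₁≤k , m≤n⇒m≤1+n k<l , pk , ¬pk

∈-range1⁺ : ∀ {N m} → 1 ≤ m → m ≤ N → m ∈ range1 N
∈-range1⁺ {m = suc j} _ j<N = ∈-map⁺ suc (∈-upTo⁺ j<N)

∈-range1⁻ : ∀ {N m} → m ∈ range1 N → 1 ≤ m × m ≤ N
∈-range1⁻ m∈ with ∈-map⁻ suc m∈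
... | _ , i∈ , refl = s≤s z≤n , ∈-upTo⁻ i∈

range1-unique : ∀ N → Unique (range1 N)
range1-unique N = Unique.map⁺ suc-injective (Unique.upTo⁺ N)

Step : ℕ → ℕ → Set
Step x y = y ≡ x ⊎ y ≡ suc x

OppositeSteps : ℕ → ℕ → ℕ → ℕ → Set
OppositeSteps x y x′ y′ = (y ≡ x × y′ ≡ suc x′) ⊎ (y ≡ suc x × y′ ≡ x′)

opposite-steps-of-join : ∀ {x y x′ y′} → Step x y → Step x′ y′ → y ≡ y′ → x ≢ x′ →
  OppositeSteps x y x′ y′
opposite-steps-of-join (inj₁ flat) (inj₁ flat′) y≡y′ x≢x′ = ⊥-elim (x≢x′ (trans (sym flat) (trans y≡y′ flat′)))
opposite-steps-of-join (inj₂ rise) (inj₂ rise′) y≡y′ x≢x′ =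
  ⊥-elim (x≢x′ (suc-injective (trans (sym rise) (trans y≡y′ rise′))))
opposite-steps-of-join (inj₁ flat) (inj₂ rise′) _ _ = inj₁ (flat , rise′)
opposite-steps-of-join (inj₂ rise) (inj₁ flat′) _ _ = inj₂ (rise , flat′)

opposite-steps-of-split : ∀ {x y x′ y′} → Step x y → Step x′ y′ → x ≡ x′ → y ≢ y′ →
  OppositeSteps x y x′ y′
opposite-steps-of-split (inj₁ flat) (inj₁ flat′) x≡x′ y≢y′ = ⊥-elim (y≢y′ (trans flat (trans x≡x′ (sym flat′))))
opposite-steps-of-split (inj₂ rise) (inj₂ rise′) x≡x′ y≢y′ =
  ⊥-elim (y≢y′ (trans rise (trans (cong suc x≡x′) (sym rise′))))
opposite-steps-of-split (inj₁ flat) (inj₂ rise′) _ _ = inj₁ (flat , rise′)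
opposite-steps-of-split (inj₂ rise) (inj₁ flat′) _ _ = inj₂ (rise , flat′)

step-≤⇔ : ∀ {x y} w → Step x y → x ≤ w ⇔ (y ≤ w ⊎ (y ≡ suc w × x ≡ w))
step-≤⇔ w (inj₁ refl) = mk⇔ inj₁ [ id , (λ { (_ , refl) → ≤-refl }) ]
step-≤⇔ w (inj₂ refl) = mk⇔ to [ <⇒≤ , (λ { (_ , refl) → ≤-refl }) ]
  where
  to : ∀ {x} → x ≤ w → suc x ≤ w ⊎ (suc x ≡ suc w × x ≡ w)
  to x≤w with m≤n⇒m<n∨m≡n x≤w
  ... | inj₁ x<w = inj₁ x<w
  ... | inj₂ refl = inj₂ (refl , refl)

step-≡⇔ : ∀ {x y} w → Step x y → y ≡ suc w ⇔ ((y ≡ suc w × x ≡ suc w) ⊎ (y ≡ suc w × x ≡ w))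
step-≡⇔ w (inj₁ refl) = mk⇔ (λ y≡ → inj₁ (y≡ , y≡)) [ proj₁ , proj₁ ]
step-≡⇔ w (inj₂ refl) = mk⇔ (λ y≡ → inj₂ (y≡ , suc-injective y≡)) [ proj₁ , proj₁ ]

solutionPoints : ℕ → ℕ → (ℕ → ℕ → ℕ) → List (ℕ × ℕ)
solutionPoints n h g = concatMap (λ m → map (λ l → (l ∸ g m l , g m l)) (range1 n)) (range1 (2 * h))

weightsOfLength : ℕ → List (ℕ × ℕ) → List ℕ
weightsOfLength l = map proj₂ ∘ filter (λ p → proj₁ p + proj₂ p ≟ l)

module CWF {n h : ℕ} {g : ℕ → ℕ → ℕ} (cwf : IsCWF n h g) where

  indices : List ℕ
  indices = range1 (2 * h)

  step : ∀ {m k} → m ∈ indices → suc k ≤ n → Step (g m k) (g m (suc k))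
  step m∈ k<n = let 1≤m , m≤2h = ∈-range1⁻ m∈ in IsCWF.step cwf _ _ (s≤s z≤n) k<n 1≤m m≤2h

  value≤length : ∀ {m l} → m ∈ indices → l ≤ n → g m l ≤ l
  value≤length {l = zero} m∈ _ = let 1≤m , m≤2h = ∈-range1⁻ m∈ in ≤-reflexive (IsCWF.start cwf _ 1≤m m≤2h)
  value≤length {l = suc k} m∈ k<n with step m∈ k<n
  ... | inj₁ flat = ≤-trans (≤-reflexive flat) (m≤n⇒m≤1+n (value≤length m∈ (<⇒≤ k<n)))
  ... | inj₂ rise = ≤-trans (≤-reflexive rise) (s≤s (value≤length m∈ (<⇒≤ k<n)))

  weightsOfLength-solutionPoints : ∀ {l} → 1 ≤ l → l ≤ n →
    weightsOfLength l (solutionPoints n h g) ≡ map (λ m → g m l) indices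
  weightsOfLength-solutionPoints {l} 1≤l l≤n = begin
    map proj₂ (filter onLength? (concatMap row indices))
      ≡⟨ cong (map proj₂) (filter-concatMap onLength? row indices) ⟩
    map proj₂ (concatMap (filter onLength? ∘ row) indices)
      ≡⟨ cong (map proj₂ ∘ concat) (map-cong-local (ListAll.tabulate row-on-length)) ⟩
    map proj₂ (concatMap (λ m → point m l ∷ []) indices)
      ≡⟨ cong (map proj₂) (concatMap-singleton (λ m → point m l) indices) ⟩
    map proj₂ (map (λ m → point m l) indices)
      ≡⟨ map-∘ indices ⟨
    map (λ m → g m l) indices ∎
    where
    open ≡-Reasoning
    point : ℕ → ℕ → ℕ × ℕ
    point m l′ = (l′ ∸ g m l′ , g m l′)
    row : ℕ → List (ℕ × ℕ)
    row m = map (point m) (range1 n)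
    onLength? : Decidable (λ (p : ℕ × ℕ) → proj₁ p + proj₂ p ≡ l)
    onLength? p = proj₁ p + proj₂ p ≟ l
    row-on-length : ∀ {m} → m ∈ indices → filter onLength? (row m) ≡ point m l ∷ []
    row-on-length m∈ = trans (filter-map onLength? (point _) (range1 n))
      (cong (map (point _)) (filter-unique (onLength? ∘ point _) (range1-unique n) (∈-range1⁺ 1≤l l≤n)
        (coordinates-sum l≤n) (λ l′∈ on → trans (sym (coordinates-sum (proj₂ (∈-range1⁻ l′∈)))) on)))
      where
      coordinates-sum : ∀ {l′} → l′ ≤ n → (l′ ∸ g _ l′) + g _ l′ ≡ l′
      coordinates-sum l′≤n = m∸n+n≡m (value≤length m∈ l′≤n)

  bcount-positive : ∀ {m k} v → m ∈ indices → g m (suc k) ≡ v → g m k ≡ v → 1 ≤ bcount h g (suc k) v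
  bcount-positive zero m∈ e _ = filter-some _ (lose m∈ e)
  bcount-positive (suc w) m∈ e e′ = filter-some _ (lose m∈ (e , e′))

  ccount-positive : ∀ {m k w} → m ∈ indices → g m (suc k) ≡ suc w → g m k ≡ w → 1 ≤ ccount h g (suc k) (suc w)
  ccount-positive m∈ e e′ = filter-some _ (lose m∈ (e , e′))

  count-≤-step : ∀ {k} → suc k ≤ n → ∀ w →
    length (filter (λ m → g m k ≤? w) indices)
      ≡ length (filter (λ m → g m (suc k) ≤? w) indices) + ccount h g (suc k) (suc w)
  count-≤-step k<n w = count-split _ _ _ (ListAll.tabulate (λ m∈ → step-≤⇔ w (step m∈ k<n)))
    λ y≤w (y≡1+w , _) → 1+n≰n (subst (_≤ w) y≡1+w y≤w)

  count-≡-step : ∀ {k} → suc k ≤ n → ∀ w →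
    length (filter (λ m → g m (suc k) ≟ suc w) indices)
      ≡ bcount h g (suc k) (suc w) + ccount h g (suc k) (suc w)
  count-≡-step k<n w = count-split _ _ _ (ListAll.tabulate (λ m∈ → step-≡⇔ w (step m∈ k<n)))
    λ (_ , x≡1+w) (_ , x≡w) → 1+n≢n (trans (sym x≡1+w) x≡w)

module SameSolution {n h : ℕ} {f f′ : ℕ → ℕ → ℕ} (cwf : IsCWF n h f) (cwf′ : IsCWF n h f′)
  (same-points : solutionPoints n h f ↭ solutionPoints n h f′) where

  open CWF cwf using (indices; step; bcount-positive; ccount-positive; count-≤-step; count-≡-step)
  open CWF cwf′ using () renaming (step to step′; bcount-positive to bcount-positive′;
    ccount-positive to ccount-positive′; count-≤-step to count-≤-step′; count-≡-step to count-≡-step′)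

  weights-↭ : ∀ {l} → 1 ≤ l → l ≤ n → map (λ m → f m l) indices ↭ map (λ m → f′ m l) indices
  weights-↭ {l} 1≤l l≤n = subst₂ _↭_
    (CWF.weightsOfLength-solutionPoints cwf 1≤l l≤n) (CWF.weightsOfLength-solutionPoints cwf′ 1≤l l≤n)
    (map⁺ proj₂ (filter-↭ (λ p → proj₁ p + proj₂ p ≟ l) same-points))

  count-invariant : (Q? : Decidable Q) → ∀ {l} → 1 ≤ l → l ≤ n →
    length (filter (λ m → Q? (f m l)) indices) ≡ length (filter (λ m → Q? (f′ m l)) indices)
  count-invariant Q? 1≤l l≤n = begin
    length (filter (λ m → Q? (f m _)) indices) ≡⟨ length-filter-map Q? (λ m → f m _) indices ⟨
    length (filter Q? (map (λ m → f m _) indices)) ≡⟨ ↭-length (filter-↭ Q? (weights-↭ 1≤l l≤n)) ⟩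
    length (filter Q? (map (λ m → f′ m _) indices)) ≡⟨ length-filter-map Q? (λ m → f′ m _) indices ⟩
    length (filter (λ m → Q? (f′ m _)) indices) ∎
    where open ≡-Reasoning

  ccount-invariant : ∀ {k} → 1 ≤ k → suc k ≤ n → ∀ w → ccount h f (suc k) w ≡ ccount h f′ (suc k) w
  ccount-invariant 1≤k k<n zero = refl
  ccount-invariant {k} 1≤k k<n (suc w) = +-cancelˡ-≡ (below f (suc k)) _ _ (begin
    below f (suc k) + ccount h f (suc k) (suc w)   ≡⟨ count-≤-step k<n w ⟨
    below f k                                       ≡⟨ count-invariant (_≤? w) 1≤k (<⇒≤ k<n) ⟩
    below f′ k                                      ≡⟨ count-≤-step′ k<n w ⟩
    below f′ (suc k) + ccount h f′ (suc k) (suc w) ≡⟨ cong (_+ _) (count-invariant (_≤? w) (s≤s z≤n) k<n) ⟨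
    below f (suc k) + ccount h f′ (suc k) (suc w)  ∎)
    where
    open ≡-Reasoning
    below : (ℕ → ℕ → ℕ) → ℕ → ℕ
    below g l = length (filter (λ m → g m l ≤? w) indices)

  bcount-invariant : ∀ {k} → 1 ≤ k → suc k ≤ n → ∀ w → bcount h f (suc k) w ≡ bcount h f′ (suc k) w
  bcount-invariant 1≤k k<n zero = count-invariant (_≟ 0) (s≤s z≤n) k<n
  bcount-invariant {k} 1≤k k<n (suc w) = +-cancelʳ-≡ (ccount h f (suc k) (suc w)) _ _ (begin
    bcount h f (suc k) (suc w) + ccount h f (suc k) (suc w)   ≡⟨ count-≡-step k<n w ⟨
    length (filter (λ m → f m (suc k) ≟ suc w) indices)       ≡⟨ count-invariant (_≟ suc w) (s≤s z≤n) k<n ⟩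
    length (filter (λ m → f′ m (suc k) ≟ suc w) indices)      ≡⟨ count-≡-step′ k<n w ⟩
    bcount h f′ (suc k) (suc w) + ccount h f′ (suc k) (suc w) ≡⟨ cong (_ +_) (ccount-invariant 1≤k k<n (suc w)) ⟨
    bcount h f′ (suc k) (suc w) + ccount h f (suc k) (suc w)  ∎)
    where open ≡-Reasoning

  branching-at-join : ∀ {m m′ k} → m ∈ indices → m′ ∈ indices → 1 ≤ k → suc k ≤ n →
    f m (suc k) ≡ f′ m′ (suc k) → f m k ≢ f′ m′ k → Branching h f (suc k) (f m (suc k))
  branching-at-join {m} {k = k} m∈ m′∈ 1≤k k<n join apart
    with opposite-steps-of-join (step m∈ k<n) (step′ m′∈ k<n) join apart
  ... | inj₁ (flat , rise′) =
    bcount-positive _ m∈ refl (sym flat) ,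
    subst (λ v → 1 ≤ ccount h f (suc k) v) (sym (trans join rise′))
      (subst (1 ≤_) (sym (ccount-invariant 1≤k k<n _)) (ccount-positive′ m′∈ rise′ refl))
  ... | inj₂ (rise , flat′) =
    subst (1 ≤_) (sym (bcount-invariant 1≤k k<n (f m (suc k))))
      (bcount-positive′ _ m′∈ (sym join) (trans (sym flat′) (sym join))) ,
    subst (λ v → 1 ≤ ccount h f (suc k) v) (sym rise) (ccount-positive m∈ rise refl)

  merging-at-split : ∀ {m m′ k} → m ∈ indices → m′ ∈ indices → 1 ≤ k → suc k ≤ n →
    f m k ≡ f′ m′ k → f m (suc k) ≢ f′ m′ (suc k) → Merging h f k (f m k)
  merging-at-split {m} {k = k} m∈ m′∈ 1≤k k<n meet apart
    with opposite-steps-of-split (step m∈ k<n) (step′ m′∈ k<n) meet apart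
  ... | inj₁ (flat , rise′) =
    bcount-positive _ m∈ flat refl ,
    subst (1 ≤_) (sym (ccount-invariant 1≤k k<n _))
      (ccount-positive′ m′∈ (trans rise′ (cong suc (sym meet))) (sym meet))
  ... | inj₂ (rise , flat′) =
    subst (1 ≤_) (sym (bcount-invariant 1≤k k<n (f m k)))
      (bcount-positive′ _ m′∈ (trans flat′ (sym meet)) (sym meet)) ,
    ccount-positive m∈ rise refl

proposition7 : (n h wbar : ℕ) → 1 ≤ n → 1 ≤ h → wbar ≤ n →
    (H : Vec (Vec Bool n) h) → All (λ t → prefWt t n ≡ wbar) H →
    (f f' : ℕ → ℕ → ℕ) → IsCWF n h f → IsCWF n h f' →
    IsSolution n h f (MH n h H) → IsSolution n h f' (MH n h H) →
    (m m' : ℕ) → 1 ≤ m → m ≤ 2 * h → 1 ≤ m' → m' ≤ 2 * h →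
    (l₁ l₂ : ℕ) → 1 ≤ l₁ → l₁ ≤ l₂ → l₂ ≤ n →
    ((f m l₂ ≡ f' m' l₂) → (f m l₁ ≢ f' m' l₁) →
       ∃[ l ] ((suc l₁ ≤ l) × (l ≤ l₂) × Branching h f l (f m l)))
    × ((f m l₂ ≢ f' m' l₂) → (f m l₁ ≡ f' m' l₁) →
       ∃[ l ] ((l₁ ≤ l) × (l ≤ l₂ ∸ 1) × Merging h f l (f m l)))
proposition7 n h wbar _ _ _ H _ f f' cwf cwf' sol sol' m m' 1≤m m≤2h 1≤m' m'≤2h l₁ l₂ 1≤l₁ l₁≤l₂ l₂≤n =
  branching , merging
  where
  open SameSolution cwf cwf' (↭-trans (↭-sym sol) sol')
  agree? : Decidable (λ l → f m l ≡ f' m' l)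
  agree? l = f m l ≟ f' m' l
  m∈ : m ∈ range1 (2 * h)
  m∈ = ∈-range1⁺ 1≤m m≤2h
  m'∈ : m' ∈ range1 (2 * h)
  m'∈ = ∈-range1⁺ 1≤m' m'≤2h
  branching : f m l₂ ≡ f' m' l₂ → f m l₁ ≢ f' m' l₁ → ∃[ l ] ((suc l₁ ≤ l) × (l ≤ l₂) × Branching h f l (f m l))
  branching agree₂ apart₁ with crossing (¬? ∘ agree?) (≤⇒≤′ l₁≤l₂) apart₁ (λ apart₂ → apart₂ agree₂)
  ... | k , l₁≤k , k<l₂ , apart , ¬apart =
    suc k , s≤s l₁≤k , k<l₂ ,
    branching-at-join m∈ m'∈ (≤-trans 1≤l₁ l₁≤k) (≤-trans k<l₂ l₂≤n) (decidable-stable (agree? (suc k)) ¬apart) apart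
  merging : f m l₂ ≢ f' m' l₂ → f m l₁ ≡ f' m' l₁ → ∃[ l ] ((l₁ ≤ l) × (l ≤ l₂ ∸ 1) × Merging h f l (f m l))
  merging apart₂ agree₁ with crossing agree? (≤⇒≤′ l₁≤l₂) agree₁ apart₂
  ... | k , l₁≤k , k<l₂ , agree , disagree =
    k , l₁≤k , ∸-monoˡ-≤ 1 k<l₂ , merging-at-split m∈ m'∈ (≤-trans 1≤l₁ l₁≤k) (≤-trans k<l₂ l₂≤n) agree disagree
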